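{- Let $q$ be a complex number with $q\neq 0,1$, let $m,r$ be complex numbers, and write $[j]_q=\frac{q^j-1}{q-1}$. For all integers $0\le k\le n$, the $(q,r)$-Whitney numbers of the second kind satisfy $$W_{m,r,q}(n,k)=q^{\binom{k}{2}}\sum_{0\leq j_1\leq j_2\leq \cdots\leq j_{n-k}\leq k}\ \prod_{i=1}^{n-k}\big(m[j_i]_q+r\big).$$
   Context: The $(q,r)$-Whitney numbers of the second kind $W_{m,r,q}(n,k)$ are defined as the coefficients in $(ma^\dagger a+r)^n=\sum_{k=0}^{n}m^kW_{m,r,q}(n,k)(a^\dagger)^k a^k$, where $a^\dagger,a$ are $q$-boson operators satisfying $aa^\dagger-qa^\dagger a=1$. Equivalently, they are the unique numbers with $W_{m,r,q}(0,0)=1$, $W_{m,r,q}(n,k)=0$ for $k<0$ or $k>n$, and the recurrence $W_{m,r,q}(n+1,k)=q^{k-1}W_{m,r,q}(n,k-1)+(m[k]_q+r)W_{m,r,q}(n,k)$ for $n\ge 0$. When $n=k$ the sum consists of the empty product $1$. -}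

module Defs where

open import Level using (Level; _⊔_) renaming (suc to lsuc)
open import Data.Nat as ℕ using (ℕ; zero; suc; _≤ᵇ_)
open import Data.Bool using (Bool; true; false; _∧_)
open import Data.List using (List; []; _∷_; map; concatMap; filter; foldr; upTo; length)
open import Data.Product using (∃)
open import Relation.Nullary using (¬_)
open import Relation.Binary.PropositionalEquality using (_≡_)
open import Data.Bool.Properties using (T?)
open import Data.Bool using (T)
open import Algebra.Bundles using (CommutativeRing)

record Field (c ℓ : Level) : Set (lsuc (c ⊔ ℓ)) where
  field
    commutativeRing : CommutativeRing c ℓ
  open CommutativeRing commutativeRing public
  field
    0≉1     : ¬ (0# ≈ 1#)
    inverse : ∀ x → ¬ (x ≈ 0#) → ∃ λ y → x * y ≈ 1#

allSeqs : ℕ → ℕ → List (List ℕ)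
allSeqs zero    b = [] ∷ []
allSeqs (suc l) b = concatMap (λ j → map (j ∷_) (allSeqs l b)) (upTo (suc b))

nondecr : List ℕ → Bool
nondecr []           = true
nondecr (x ∷ [])     = true
nondecr (x ∷ y ∷ xs) = (x ≤ᵇ y) ∧ nondecr (y ∷ xs)

incSeqs : ℕ → ℕ → List (List ℕ)
incSeqs l b = filter (λ s → T? (nondecr s)) (allSeqs l b)

module _ {c ℓ : Level} (R : CommutativeRing c ℓ) where
  open CommutativeRing R

  pow : Carrier → ℕ → Carrier
  pow x zero    = 1#
  pow x (suc n) = x * pow x n

  sumR : List Carrier → Carrier
  sumR = foldr _+_ 0#

  prodR : List Carrier → Carrier
  prodR = foldr _*_ 1#

  -- [j]_q = (q^j - 1)/(q - 1), where invq1 is the inverse of (q - 1)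
  qint : (q invq1 : Carrier) → ℕ → Carrier
  qint q invq1 j = (pow q j - 1#) * invq1

  -- (q,r)-Whitney numbers of the second kind via the defining recurrence
  -- W(n+1,k) = q^{k-1} W(n,k-1) + (m[k]_q + r) W(n,k), W(0,0)=1, W(n,k)=0 for k<0 or k>n.
  W : (q invq1 m r : Carrier) → ℕ → ℕ → Carrier
  W q i m r zero    zero    = 1#
  W q i m r zero    (suc k) = 0#
  W q i m r (suc n) zero    = (m * qint q i 0 + r) * W q i m r n 0
  W q i m r (suc n) (suc k) =
    pow q k * W q i m r n k + (m * qint q i (suc k) + r) * W q i m r n (suc k)

module Submission where

open import Defs
open import Level using (Level)
open import Data.Nat using (ℕ; _≤_; _∸_)
open import Data.Nat.Combinatorics using (_C_)
open import Data.List using (map)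
open import Relation.Nullary using (¬_)

open import Data.Nat using (zero; suc; _<_; _≤ᵇ_; s≤s; z≤n)
import Data.Nat as ℕ
import Data.Nat.Properties as ℕ
open import Data.Nat.Properties
  using (≤ᵇ⇒≤; ≤⇒≤ᵇ; <⇒≱; ≤-pred; ≤-refl; ≤-reflexive; m≤n⇒m≤1+n; m+[n∸m]≡n)
open import Data.Nat.Combinatorics using (nC1≡n; nCk+nC[k+1]≡[n+1]C[k+1])
open import Data.Bool using (Bool; true; false; _∧_; T)
open import Data.Bool.Properties using (T?)
open import Data.List using (List; []; _∷_; _++_; filter; concatMap; upTo)
open import Data.List.Properties using (upTo-∷ʳ)
open import Data.Empty using (⊥-elim)
open import Relation.Binary.PropositionalEquality as ≡ using (_≡_)
open import Algebra.Bundles using (CommutativeRing)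

-- Write a_j = m[j]_q + r and let H l j b be the complete homogeneous sum
--   H l j b = Σ_{j ≤ i₁ ≤ ⋯ ≤ i_l ≤ b} a_{i₁} ⋯ a_{i_l},
-- defined by choosing the smallest index first:
--   H 0 j b = 1,   H (l+1) j b = Σ_{j ≤ i ≤ b} a_i · H l i b.
-- Two facts about H are proved for an arbitrary sequence a in a commutative ring:
--   * it equals the enumerated sum of the statement (sum over all bounded
--     sequences, filtered to the weakly increasing ones), and
--   * splitting off the largest value b+1 gives the recursion at the top end
--     H (l+1) j (b+1) = H (l+1) j b + a_{b+1} · H l j (b+1)   (j ≤ b+1).
-- The second fact has exactly the shape of the Whitney recurrence, so induction
-- gives W(k+l, k) = q^{C(k,2)} · H l 0 k, using q^k · q^{C(k,2)} = q^{C(k+1,2)};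
-- the theorem is the case l = n ∸ k.

module Sums {c ℓ : Level} (R : CommutativeRing c ℓ) where
  open CommutativeRing R hiding (zero)
  open import Relation.Binary.Reasoning.Setoid setoid
  open import Algebra.Properties.CommutativeSemigroup +-commutativeSemigroup using (interchange)

  guard : Bool → Carrier → Carrier
  guard true  x = x
  guard false x = 0#

  guard-cong : ∀ β {x y} → x ≈ y → guard β x ≈ guard β y
  guard-cong true  x≈y = x≈y
  guard-cong false x≈y = refl

  guard-T : ∀ β x → T β → guard β x ≈ x
  guard-T true x _ = refl

  guard-¬T : ∀ β x → ¬ T β → guard β x ≈ 0#
  guard-¬T true  x ¬t = ⊥-elim (¬t _)
  guard-¬T false x ¬t = refl

  guard-* : ∀ β a x → guard β (a * x) ≈ a * guard β x
  guard-* true  a x = refl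
  guard-* false a x = sym (zeroʳ a)

  guard-∧ : ∀ β γ a x → guard (β ∧ γ) (a * x) ≈ guard β (a * guard γ x)
  guard-∧ true  γ a x = guard-* γ a x
  guard-∧ false γ a x = refl

  σ : {A : Set} → List A → (A → Carrier) → Carrier
  σ xs g = sumR R (map g xs)

  σ-cong : {A : Set} (xs : List A) {g h : A → Carrier} → (∀ x → g x ≈ h x) → σ xs g ≈ σ xs h
  σ-cong []       g≈h = refl
  σ-cong (x ∷ xs) g≈h = +-cong (g≈h x) (σ-cong xs g≈h)

  σ-++ : {A : Set} (xs ys : List A) (g : A → Carrier) → σ (xs ++ ys) g ≈ σ xs g + σ ys g
  σ-++ []       ys g = sym (+-identityˡ _)
  σ-++ (x ∷ xs) ys g = trans (+-congˡ (σ-++ xs ys g)) (sym (+-assoc _ _ _))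

  σ-concatMap : {A B : Set} (xs : List A) (f : A → List B) (g : B → Carrier) →
    σ (concatMap f xs) g ≈ σ xs (λ x → σ (f x) g)
  σ-concatMap []       f g = refl
  σ-concatMap (x ∷ xs) f g = trans (σ-++ (f x) (concatMap f xs) g) (+-congˡ (σ-concatMap xs f g))

  σ-map : {A B : Set} (xs : List A) (f : A → B) (g : B → Carrier) →
    σ (map f xs) g ≈ σ xs (λ x → g (f x))
  σ-map []       f g = refl
  σ-map (x ∷ xs) f g = +-congˡ (σ-map xs f g)

  σ-filter : {A : Set} (xs : List A) (p : A → Bool) (g : A → Carrier) →
    σ (filter (λ x → T? (p x)) xs) g ≈ σ xs (λ x → guard (p x) (g x))
  σ-filter []       p g = refl
  σ-filter (x ∷ xs) p g with p x
  ... | true  = +-congˡ (σ-filter xs p g)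
  ... | false = trans (σ-filter xs p g) (sym (+-identityˡ _))

  σ-* : {A : Set} (xs : List A) (a : Carrier) (g : A → Carrier) → σ xs (λ x → a * g x) ≈ a * σ xs g
  σ-* []       a g = sym (zeroʳ a)
  σ-* (x ∷ xs) a g = trans (+-congˡ (σ-* xs a g)) (sym (distribˡ a _ _))

  σ-guard : {A : Set} (xs : List A) (β : Bool) (g : A → Carrier) →
    σ xs (λ x → guard β (g x)) ≈ guard β (σ xs g)
  σ-guard xs       true  g = refl
  σ-guard []       false g = refl
  σ-guard (x ∷ xs) false g = trans (+-identityˡ _) (σ-guard xs false g)

  Σ< : ℕ → (ℕ → Carrier) → Carrier
  Σ< zero    g = 0#
  Σ< (suc n) g = Σ< n g + g n

  σ-upTo : (n : ℕ) (g : ℕ → Carrier) → σ (upTo n) g ≈ Σ< n g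
  σ-upTo zero    g = refl
  σ-upTo (suc n) g = begin
    σ (upTo (suc n)) g        ≡⟨ ≡.cong (λ xs → σ xs g) (≡.sym (upTo-∷ʳ n)) ⟩
    σ (upTo n ++ n ∷ []) g    ≈⟨ σ-++ (upTo n) (n ∷ []) g ⟩
    σ (upTo n) g + (g n + 0#) ≈⟨ +-cong (σ-upTo n g) (+-identityʳ _) ⟩
    Σ< n g + g n              ∎

  Σ<-cong : (n : ℕ) {g h : ℕ → Carrier} → (∀ i → i < n → g i ≈ h i) → Σ< n g ≈ Σ< n h
  Σ<-cong zero    g≈h = refl
  Σ<-cong (suc n) g≈h = +-cong (Σ<-cong n (λ i i<n → g≈h i (m≤n⇒m≤1+n i<n))) (g≈h n ≤-refl)

  Σ<-zero : (n : ℕ) (g : ℕ → Carrier) → (∀ i → i < n → g i ≈ 0#) → Σ< n g ≈ 0#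
  Σ<-zero n g g≈0 = trans (Σ<-cong n g≈0) (Σ<-const-0 n)
    where
    Σ<-const-0 : ∀ n → Σ< n (λ _ → 0#) ≈ 0#
    Σ<-const-0 zero    = refl
    Σ<-const-0 (suc n) = trans (+-identityʳ _) (Σ<-const-0 n)

  Σ<-+ : (n : ℕ) (g h : ℕ → Carrier) → Σ< n (λ i → g i + h i) ≈ Σ< n g + Σ< n h
  Σ<-+ zero    g h = sym (+-identityˡ 0#)
  Σ<-+ (suc n) g h = trans (+-congʳ (Σ<-+ n g h)) (interchange _ _ _ _)

  Σ<-* : (n : ℕ) (a : Carrier) (g : ℕ → Carrier) → Σ< n (λ i → a * g i) ≈ a * Σ< n g
  Σ<-* zero    a g = sym (zeroʳ a)
  Σ<-* (suc n) a g = trans (+-congʳ (Σ<-* n a g)) (sym (distribˡ a _ _))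

  Σ-from : ℕ → ℕ → (ℕ → Carrier) → Carrier
  Σ-from j b g = Σ< (suc b) (λ i → guard (j ≤ᵇ i) (g i))

  Σ-from-cong : ∀ j b {g h : ℕ → Carrier} → (∀ i → i ≤ b → g i ≈ h i) → Σ-from j b g ≈ Σ-from j b h
  Σ-from-cong j b g≈h = Σ<-cong (suc b) (λ i i<1+b → guard-cong (j ≤ᵇ i) (g≈h i (≤-pred i<1+b)))

  Σ-from-+ : ∀ j b (g h : ℕ → Carrier) → Σ-from j b (λ i → g i + h i) ≈ Σ-from j b g + Σ-from j b h
  Σ-from-+ j b g h = trans (Σ<-cong (suc b) (λ i _ → guard-+ (j ≤ᵇ i))) (Σ<-+ (suc b) _ _)
    where
    guard-+ : ∀ {i} β → guard β (g i + h i) ≈ guard β (g i) + guard β (h i)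
    guard-+ true  = refl
    guard-+ false = sym (+-identityˡ 0#)

  Σ-from-* : ∀ j b a (g : ℕ → Carrier) → Σ-from j b (λ i → a * g i) ≈ a * Σ-from j b g
  Σ-from-* j b a g = trans (Σ<-cong (suc b) (λ i _ → guard-* (j ≤ᵇ i) a (g i))) (Σ<-* (suc b) a _)

  Σ-from-last : ∀ j b (g : ℕ → Carrier) → j ≤ suc b → Σ-from j (suc b) g ≈ Σ-from j b g + g (suc b)
  Σ-from-last j b g j≤1+b = +-congˡ (guard-T (j ≤ᵇ suc b) (g (suc b)) (≤⇒≤ᵇ j≤1+b))

  Σ-from-single : ∀ b (g : ℕ → Carrier) → Σ-from b b g ≈ g b
  Σ-from-single b g = begin
    Σ< b (λ i → guard (b ≤ᵇ i) (g i)) + guard (b ≤ᵇ b) (g b)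
      ≈⟨ +-cong (Σ<-zero b _ below) (guard-T (b ≤ᵇ b) (g b) (≤⇒≤ᵇ (≤-refl {b}))) ⟩
    0# + g b ≈⟨ +-identityˡ _ ⟩
    g b      ∎
    where
    below : ∀ i → i < b → guard (b ≤ᵇ i) (g i) ≈ 0#
    below i i<b = guard-¬T (b ≤ᵇ i) (g i) (λ t → <⇒≱ i<b (≤ᵇ⇒≤ b i t))

module Homogeneous {c ℓ : Level} (R : CommutativeRing c ℓ) (a : ℕ → CommutativeRing.Carrier R) where
  open CommutativeRing R hiding (zero)
  open Sums R
  open import Relation.Binary.Reasoning.Setoid setoid
  open import Algebra.Properties.CommutativeSemigroup *-commutativeSemigroup using (x∙yz≈y∙xz)

  H : ℕ → ℕ → ℕ → Carrier
  H zero    j b = 1#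
  H (suc l) j b = Σ-from j b (λ i → a i * H l i b)

  H-diag : ∀ l b → H (suc l) b b ≈ a b * H l b b
  H-diag l b = Σ-from-single b (λ i → a i * H l i b)

  -- Top-end recursion: sequences in [j, b+1] either avoid b+1, or end with it.
  H-top : ∀ l j b → j ≤ suc b → H (suc l) j (suc b) ≈ H (suc l) j b + a (suc b) * H l j (suc b)
  H-top zero    j b j≤B = Σ-from-last j b (λ i → a i * 1#) j≤B
  H-top (suc l) j b j≤B = begin
    H (suc (suc l)) j B
      ≈⟨ Σ-from-last j b (λ i → a i * H (suc l) i B) j≤B ⟩
    Σ-from j b (λ i → a i * H (suc l) i B) + a B * H (suc l) B B
      ≈⟨ +-cong (Σ-from-cong j b split) (*-congˡ (H-diag l B)) ⟩
    Σ-from j b (λ i → a i * H (suc l) i b + a B * (a i * H l i B)) + a B * (a B * H l B B)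
      ≈⟨ +-congʳ (trans (Σ-from-+ j b _ _) (+-congˡ (Σ-from-* j b (a B) _))) ⟩
    (H (suc (suc l)) j b + a B * Σ-from j b (λ i → a i * H l i B)) + a B * (a B * H l B B)
      ≈⟨ +-assoc _ _ _ ⟩
    H (suc (suc l)) j b + (a B * Σ-from j b (λ i → a i * H l i B) + a B * (a B * H l B B))
      ≈⟨ +-congˡ (sym (distribˡ (a B) _ _)) ⟩
    H (suc (suc l)) j b + a B * (Σ-from j b (λ i → a i * H l i B) + a B * H l B B)
      ≈⟨ +-congˡ (*-congˡ (sym (Σ-from-last j b (λ i → a i * H l i B) j≤B))) ⟩
    H (suc (suc l)) j b + a B * H (suc l) j B ∎
    where
    B = suc b
    split : ∀ i → i ≤ b → a i * H (suc l) i B ≈ a i * H (suc l) i b + a B * (a i * H l i B)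
    split i i≤b = begin
      a i * H (suc l) i B                          ≈⟨ *-congˡ (H-top l i b (m≤n⇒m≤1+n i≤b)) ⟩
      a i * (H (suc l) i b + a B * H l i B)          ≈⟨ distribˡ (a i) _ _ ⟩
      a i * H (suc l) i b + a i * (a B * H l i B)    ≈⟨ +-congˡ (x∙yz≈y∙xz (a i) (a B) _) ⟩
      a i * H (suc l) i b + a B * (a i * H l i B)    ∎

  weight : List ℕ → Carrier
  weight s = prodR R (map a s)

  H-enum : ∀ l j b → σ (allSeqs l b) (λ s → guard (nondecr (j ∷ s)) (weight s)) ≈ H l j b
  H-enum zero    j b = +-identityʳ 1#
  H-enum (suc l) j b = begin
    σ (concatMap (λ i → map (i ∷_) (allSeqs l b)) (upTo (suc b))) keep
      ≈⟨ σ-concatMap (upTo (suc b)) (λ i → map (i ∷_) (allSeqs l b)) keep ⟩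
    σ (upTo (suc b)) (λ i → σ (map (i ∷_) (allSeqs l b)) keep)
      ≈⟨ σ-cong (upTo (suc b)) (λ i → σ-map (allSeqs l b) (i ∷_) keep) ⟩
    σ (upTo (suc b)) (λ i → σ (allSeqs l b) (λ s → guard ((j ≤ᵇ i) ∧ nondecr (i ∷ s)) (a i * weight s)))
      ≈⟨ σ-cong (upTo (suc b)) first-index ⟩
    σ (upTo (suc b)) (λ i → guard (j ≤ᵇ i) (a i * H l i b))
      ≈⟨ σ-upTo (suc b) _ ⟩
    H (suc l) j b ∎
    where
    keep : List ℕ → Carrier
    keep s = guard (nondecr (j ∷ s)) (weight s)
    first-index : ∀ i → σ (allSeqs l b) (λ s → guard ((j ≤ᵇ i) ∧ nondecr (i ∷ s)) (a i * weight s))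
                        ≈ guard (j ≤ᵇ i) (a i * H l i b)
    first-index i = begin
      σ (allSeqs l b) (λ s → guard ((j ≤ᵇ i) ∧ nondecr (i ∷ s)) (a i * weight s))
        ≈⟨ σ-cong (allSeqs l b) (λ s → guard-∧ (j ≤ᵇ i) (nondecr (i ∷ s)) (a i) (weight s)) ⟩
      σ (allSeqs l b) (λ s → guard (j ≤ᵇ i) (a i * guard (nondecr (i ∷ s)) (weight s)))
        ≈⟨ σ-guard (allSeqs l b) (j ≤ᵇ i) _ ⟩
      guard (j ≤ᵇ i) (σ (allSeqs l b) (λ s → a i * guard (nondecr (i ∷ s)) (weight s)))
        ≈⟨ guard-cong (j ≤ᵇ i) (trans (σ-* (allSeqs l b) (a i) _) (*-congˡ (H-enum l i b))) ⟩
      guard (j ≤ᵇ i) (a i * H l i b) ∎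

  nondecr-0∷ : ∀ s → nondecr s ≡ nondecr (0 ∷ s)
  nondecr-0∷ []      = ≡.refl
  nondecr-0∷ (x ∷ s) = ≡.refl

  H-incSeqs : ∀ l b → σ (incSeqs l b) weight ≈ H l 0 b
  H-incSeqs l b = begin
    σ (incSeqs l b) weight
      ≈⟨ σ-filter (allSeqs l b) nondecr weight ⟩
    σ (allSeqs l b) (λ s → guard (nondecr s) (weight s))
      ≈⟨ σ-cong (allSeqs l b) (λ s → ≡.subst (λ β → guard (nondecr s) (weight s) ≈ guard β (weight s))
                                            (nondecr-0∷ s) refl) ⟩
    σ (allSeqs l b) (λ s → guard (nondecr (0 ∷ s)) (weight s))
      ≈⟨ H-enum l 0 b ⟩
    H l 0 b ∎

module Whitney {c ℓ : Level} (R : CommutativeRing c ℓ) (q m r invq1 : CommutativeRing.Carrier R) where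
  open CommutativeRing R hiding (zero)
  open import Relation.Binary.Reasoning.Setoid setoid
  open import Algebra.Properties.CommutativeSemigroup *-commutativeSemigroup using (x∙yz≈y∙xz)

  a : ℕ → Carrier
  a j = m * qint R q invq1 j + r

  open Sums R using (σ)
  open Homogeneous R a using (H; H-diag; H-top; weight; H-incSeqs)

  Wh : ℕ → ℕ → Carrier
  Wh = W R q invq1 m r

  P : ℕ → Carrier
  P k = pow R q (k C 2)

  pow-+ : ∀ x y → pow R q (x ℕ.+ y) ≈ pow R q x * pow R q y
  pow-+ zero    y = sym (*-identityˡ _)
  pow-+ (suc x) y = trans (*-congˡ (pow-+ x y)) (sym (*-assoc _ _ _))

  -- q^k · q^{C(k,2)} = q^{C(k+1,2)}, since k + C(k,2) = C(k+1,2) (Pascal's rule).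
  pow-step : ∀ k x → pow R q k * (P k * x) ≈ P (suc k) * x
  pow-step k x = begin
    pow R q k * (P k * x)          ≈⟨ sym (*-assoc _ _ _) ⟩
    (pow R q k * P k) * x          ≈⟨ *-congʳ (sym (pow-+ k (k C 2))) ⟩
    pow R q (k ℕ.+ k C 2) * x      ≡⟨ ≡.cong (λ e → pow R q (e ℕ.+ k C 2) * x) (≡.sym (nC1≡n k)) ⟩
    pow R q (k C 1 ℕ.+ k C 2) * x  ≡⟨ ≡.cong (λ e → pow R q e * x) (nCk+nC[k+1]≡[n+1]C[k+1] k 1) ⟩
    P (suc k) * x                  ∎

  W-above : ∀ n k → n < k → Wh n k ≈ 0#
  W-above zero    (suc k) _         = refl
  W-above (suc n) (suc k) (s≤s n<k) = begin
    pow R q k * Wh n k + a (suc k) * Wh n (suc k)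
      ≈⟨ +-cong (*-congˡ (W-above n k n<k)) (*-congˡ (W-above n (suc k) (m≤n⇒m≤1+n n<k))) ⟩
    pow R q k * 0# + a (suc k) * 0# ≈⟨ +-cong (zeroʳ _) (zeroʳ _) ⟩
    0# + 0#                         ≈⟨ +-identityʳ 0# ⟩
    0#                              ∎

  -- Closed form along the l-th diagonal, by induction on k and l, matching the
  -- Whitney recurrence with the top-end recursion of H.
  W-diagonal : ∀ k l → Wh (k ℕ.+ l) k ≈ P k * H l 0 k
  W-diagonal zero zero = sym (*-identityˡ 1#)
  W-diagonal zero (suc l) = begin
    a 0 * Wh l 0     ≈⟨ *-congˡ (trans (W-diagonal zero l) (*-identityˡ _)) ⟩
    a 0 * H l 0 0    ≈⟨ sym (H-diag l 0) ⟩
    H (suc l) 0 0    ≈⟨ sym (*-identityˡ _) ⟩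
    1# * H (suc l) 0 0 ∎
  W-diagonal (suc k) zero = begin
    pow R q k * Wh (k ℕ.+ 0) k + a (suc k) * Wh (k ℕ.+ 0) (suc k)
      ≈⟨ +-cong (*-congˡ (W-diagonal k zero)) (*-congˡ (W-above (k ℕ.+ 0) (suc k) k+0<1+k)) ⟩
    pow R q k * (P k * 1#) + a (suc k) * 0#
      ≈⟨ +-cong (pow-step k 1#) (zeroʳ _) ⟩
    P (suc k) * 1# + 0# ≈⟨ +-identityʳ _ ⟩
    P (suc k) * 1#      ∎
    where
    k+0<1+k : k ℕ.+ 0 < suc k
    k+0<1+k = s≤s (≤-reflexive (ℕ.+-identityʳ k))
  W-diagonal (suc k) (suc l) = begin
    pow R q k * Wh (k ℕ.+ suc l) k + a (suc k) * Wh (k ℕ.+ suc l) (suc k)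
      ≡⟨ ≡.cong (λ n → pow R q k * Wh (k ℕ.+ suc l) k + a (suc k) * Wh n (suc k)) (ℕ.+-suc k l) ⟩
    pow R q k * Wh (k ℕ.+ suc l) k + a (suc k) * Wh (suc k ℕ.+ l) (suc k)
      ≈⟨ +-cong (*-congˡ (W-diagonal k (suc l))) (*-congˡ (W-diagonal (suc k) l)) ⟩
    pow R q k * (P k * H (suc l) 0 k) + a (suc k) * (P (suc k) * H l 0 (suc k))
      ≈⟨ +-cong (pow-step k _) (x∙yz≈y∙xz (a (suc k)) (P (suc k)) _) ⟩
    P (suc k) * H (suc l) 0 k + P (suc k) * (a (suc k) * H l 0 (suc k))
      ≈⟨ sym (distribˡ _ _ _) ⟩
    P (suc k) * (H (suc l) 0 k + a (suc k) * H l 0 (suc k))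
      ≈⟨ *-congˡ (sym (H-top l 0 k z≤n)) ⟩
    P (suc k) * H (suc l) 0 (suc k) ∎

  W-closed-form : ∀ n k → k ≤ n → Wh n k ≈ P k * σ (incSeqs (n ∸ k) k) weight
  W-closed-form n k k≤n =
    ≡.subst (λ n′ → Wh n′ k ≈ P k * σ (incSeqs (n ∸ k) k) weight) (m+[n∸m]≡n k≤n)
      (trans (W-diagonal k (n ∸ k)) (*-congˡ (sym (H-incSeqs (n ∸ k) k))))

theorem4 : ∀ {c ℓ : Level} (F : Field c ℓ) → let open Field F in
    (q m r : Carrier) → ¬ (q ≈ 0#) → ¬ (q ≈ 1#) →
    (invq1 : Carrier) → (q - 1#) * invq1 ≈ 1# →
    (n k : ℕ) → k ≤ n →
    W commutativeRing q invq1 m r n k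
      ≈ pow commutativeRing q (k C 2)
        * sumR commutativeRing
            (map (λ js → prodR commutativeRing
                           (map (λ j → m * qint commutativeRing q invq1 j + r) js))
                 (incSeqs (n ∸ k) k))
theorem4 F q m r _ _ invq1 _ = Whitney.W-closed-form (Field.commutativeRing F) q m r invq1
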